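{- Let $n\ge 1$. For a string $X=(X_1,\ldots,X_n)\in\{0,1,2,3\}^n$ define the subset of real $3\times n$ matrices \[ \Delta_X=\{M\in\mathbb{R}^{3\times n}:\ M_{ij}=0 \text{ if } i\neq X_j,\ \ M_{ij}\ge 0 \text{ if } i=X_j\}. \] Then, as $X$ ranges over all strings in $\{0,1,2,3\}^n$ other than the four constant strings $(0,\ldots,0),(1,\ldots,1),(2,\ldots,2),(3,\ldots,3)$, the sets $\Delta_X$ are simplicial cones forming a simplicial complex (any two intersect in a common face, namely $\Delta_X\cap\Delta_Y=\Delta_Z$ where $Z_j=X_j$ if $X_j=Y_j$ and $Z_j=0$ otherwise). Moreover, the facets of $\Delta_X$ are exactly the cones $\Delta_Y$, where $Y$ ranges over the strings obtained from $X$ by changing exactly one nonzero entry to $0$.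
   Context: Tropical setting: the tropical semiring is $(\mathbb{R},\min,+)$, and $\mathbb{TP}^2=\mathbb{R}^3/\mathbb{R}(1,1,1)$. A $3\times n$ matrix of tropical rank two, viewed as $n$ points (its columns) in $\mathbb{TP}^2$ lying on a tropical line, can (after translating rows/columns and removing the trivial configuration) be normalized so that all points lie on the standard tropical line with apex at the origin, i.e. each column equals $t e_i$ for some $t\ge 0$ and some $i\in\{1,2,3\}$, not all points in the relative interior of one branch. For such a matrix $M$, $\phi(M)\in\{0,1,2,3\}^n$ records for each column $j$ the value $0$ if column $j$ is zero and $i$ if column $j=te_i$ with $t>0$; $\Delta_X$ is the topological closure of $\phi^{ -1}(X)$, explicitly given by the displayed formula. -}

module Defs where

open import Level using (0ℓ)
open import Data.Nat using (ℕ; zero; suc)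
open import Data.Fin using (Fin; zero; suc)
open import Data.Product using (Σ; ∃; ∃-syntax; _×_; _,_)
open import Data.Empty using (⊥)
open import Relation.Nullary using (¬_; yes; no)
open import Relation.Binary.PropositionalEquality using (_≡_; _≢_)
open import Relation.Binary using (Rel; IsTotalOrder)
open import Algebra.Structures using (IsCommutativeRing)
import Data.Fin as F

-- A Dedekind-complete ordered field (with propositional equality).
-- Up to isomorphism the only such structure is ℝ; stdlib has no reals,
-- so the theorem is stated for every complete ordered field.
record CompleteOrderedField : Set₁ where
  infixl 6 _+_
  infixl 7 _*_
  infix 4 _≤_
  field
    Carrier : Set
    0# 1# : Carrier
    _+_ _*_ : Carrier → Carrier → Carrier
    -_ : Carrier → Carrier
    isCommutativeRing : IsCommutativeRing _≡_ _+_ _*_ -_ 0# 1#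
    0≢1 : 0# ≢ 1#
    inverse : ∀ x → x ≢ 0# → ∃[ y ] (x * y ≡ 1#)
    _≤_ : Rel Carrier 0ℓ
    isTotalOrder : IsTotalOrder _≡_ _≤_
    +-mono-≤ : ∀ {x y} z → x ≤ y → x + z ≤ y + z
    *-nonneg : ∀ {x y} → 0# ≤ x → 0# ≤ y → 0# ≤ x * y
    complete : (P : Carrier → Set) → ∃[ x ] P x → (∃[ b ] (∀ x → P x → x ≤ b)) →
               ∃[ s ] ((∀ x → P x → x ≤ s) × (∀ b → (∀ x → P x → x ≤ b) → s ≤ b))

-- Strings in {0,1,2,3}^n : label 0 = zero, label i (i=1,2,3) = suc (row index)
Str : ℕ → Set
Str n = Fin n → Fin 4

Constant : ∀ {n} → Str n → Set
Constant {n} X = ∃[ c ] (∀ j → X j ≡ c)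

NonConstant : ∀ {n} → Str n → Set
NonConstant X = ¬ Constant X

meet : ∀ {n} → Str n → Str n → Str n
meet X Y j with X j F.≟ Y j
... | yes _ = X j
... | no  _ = zero

zeroAt : ∀ {n} → Str n → Fin n → Str n
zeroAt X j k with k F.≟ j
... | yes _ = zero
... | no  _ = X k

module Cones (K : CompleteOrderedField) where
  open CompleteOrderedField K

  Mat : ℕ → Set
  Mat n = Fin 3 → Fin n → Carrier

  sumFin : ∀ {d} → (Fin d → Carrier) → Carrier
  sumFin {zero}  f = 0#
  sumFin {suc d} f = f zero + sumFin (λ k → f (suc k))

  _≐_ : ∀ {n} → (Mat n → Set) → (Mat n → Set) → Set
  P ≐ Q = ∀ M → (P M → Q M) × (Q M → P M)

  _∩_ : ∀ {n} → (Mat n → Set) → (Mat n → Set) → (Mat n → Set)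
  (P ∩ Q) M = P M × Q M

  Δ : ∀ {n} → Str n → Mat n → Set
  Δ X M = ∀ i j → (X j ≡ suc i → 0# ≤ M i j) × (X j ≢ suc i → M i j ≡ 0#)

  lincomb : ∀ {n d} → (Fin d → Carrier) → (Fin d → Mat n) → Mat n
  lincomb c g i j = sumFin (λ k → c k * g k i j)

  LinIndep : ∀ {n d} → (Fin d → Mat n) → Set
  LinIndep g = ∀ c → (∀ i j → lincomb c g i j ≡ 0#) → ∀ k → c k ≡ 0#

  SimplicialCone : ∀ {n} → (Mat n → Set) → Set
  SimplicialCone {n} C = ∃[ d ] Σ (Fin d → Mat n) λ g → LinIndep g ×
    (∀ M → (C M → ∃[ c ] ((∀ k → 0# ≤ c k) × (∀ i j → M i j ≡ lincomb c g i j)))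
         × (∃[ c ] ((∀ k → 0# ≤ c k) × (∀ i j → M i j ≡ lincomb c g i j)) → C M))

  pair : ∀ {n} → Mat n → Mat n → Carrier
  pair W M = sumFin (λ i → sumFin (λ j → W i j * M i j))

  Face : ∀ {n} → (Mat n → Set) → (Mat n → Set) → Set
  Face {n} F C = Σ (Mat n) λ W → (∀ M → C M → 0# ≤ pair W M) ×
    (∀ M → (F M → C M × pair W M ≡ 0#) × (C M × pair W M ≡ 0# → F M))

  HasDim : ∀ {n} → (Mat n → Set) → ℕ → Set
  HasDim {n} C d = (Σ (Fin d → Mat n) λ g → (∀ k → C (g k)) × LinIndep g)
                 × ((g : Fin (suc d) → Mat n) → (∀ k → C (g k)) → ¬ LinIndep g)

  Facet : ∀ {n} → (Mat n → Set) → (Mat n → Set) → Set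
  Facet F C = Face F C × ∃[ d ] (HasDim C (suc d) × HasDim F d)

-- Δ X is the nonnegative cone on the unit matrices at the nonzero entries of X, hence
-- simplicial of dimension #nonzero X.  Zeroing entries of X gives its faces: Δ Z is cut out
-- of Δ X by the sum of the entries in the columns that Z zeroes, and Δ X ∩ Δ Y = Δ (meet X Y).
-- Conversely, if ⟨W, ·⟩ ≥ 0 on Δ X cuts out a facet G, the weights of W at the generators
-- are ≥ 0; they cannot all vanish (G would be Δ X) and two cannot be nonzero (G would lie in
-- a cone of codimension two), so exactly one column j carries weight and G = Δ (zeroAt X j).
-- Dimensions are compared by Gaussian elimination: m independent vectors in K^d force m ≤ d.
module Submission where

open import Defs
open import Data.Nat using (ℕ; _≤_)
open import Data.Fin using (Fin; zero)
open import Data.Product using (Σ; ∃; ∃-syntax; _×_; _,_)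
open import Relation.Binary.PropositionalEquality using (_≡_; _≢_)

open import Level using (0ℓ)
import Data.Nat as ℕ
open import Algebra.Bundles using (CommutativeRing)
open import Data.Bool using (Bool; true; false; if_then_else_)
open import Data.Empty using (⊥-elim)
open import Data.Fin using (suc; punchIn; _≟_)
open import Data.Fin.Properties using (suc-injective; punchInᵢ≢i)
open import Data.Nat.Properties using (m≤n⇒m≤1+n; m≤n⇒m<n∨m≡n; ≤-antisym; n≮n)
open import Data.Product using (proj₁; proj₂)
open import Data.Sum using (_⊎_; inj₁; inj₂)
open import Data.List using (allFin)
open import Data.List.Membership.Propositional.Properties using (∈-allFin)
import Data.List.Relation.Unary.All as All
open import Data.Vec.Functional using (insertAt; _∷_)
open import Data.Vec.Functional.Properties using (insertAt-lookup; insertAt-punchIn)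
open import Function using (_∘_)
open import Relation.Nullary using (¬_; Dec; yes; no; _×-dec_)
open import Relation.Nullary.Decidable using (decidable-stable; ¬¬-excluded-middle)
open import Relation.Nullary.Negation using (¬¬-map)
open import Relation.Binary.PropositionalEquality
  using (refl; sym; trans; cong; cong₂; subst; subst₂; _≗_)
open import Relation.Binary.PropositionalEquality.Properties using (module ≡-Reasoning)
open import Relation.Binary.Bundles using (TotalOrder)
open import Relation.Binary.Structures using (IsTotalOrder)

-- Enumerating the elements of Fin n that satisfy a predicate

count : ∀ {n} → (Fin n → Bool) → ℕ
count {ℕ.zero}  p = 0
count {ℕ.suc n} p = if p zero then ℕ.suc (count (p ∘ suc)) else count (p ∘ suc)

enumCons : ∀ {m n} b → (Fin m → Fin n) → Fin (if b then ℕ.suc m else m) → Fin (ℕ.suc n)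
enumCons true  e zero    = zero
enumCons true  e (suc k) = suc (e k)
enumCons false e k       = suc (e k)

enum : ∀ {n} (p : Fin n → Bool) → Fin (count p) → Fin n
enum {ℕ.suc n} p = enumCons (p zero) (enum (p ∘ suc))

enum-true : ∀ {n} (p : Fin n → Bool) k → p (enum p k) ≡ true
enum-true {ℕ.suc n} p k with p zero in eq
enum-true {ℕ.suc n} p zero    | true  = eq
enum-true {ℕ.suc n} p (suc k) | true  = enum-true (p ∘ suc) k
enum-true {ℕ.suc n} p k       | false = enum-true (p ∘ suc) k

enum-injective : ∀ {n} (p : Fin n → Bool) {k l} → enum p k ≡ enum p l → k ≡ l
enum-injective {ℕ.suc n} p e with p zero
enum-injective {ℕ.suc n} p {zero}  {zero}  e | true  = refl
enum-injective {ℕ.suc n} p {suc k} {suc l} e | true  = cong suc (enum-injective (p ∘ suc) (suc-injective e))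
enum-injective {ℕ.suc n} p                 e | false = enum-injective (p ∘ suc) (suc-injective e)

enum-surjective : ∀ {n} (p : Fin n → Bool) {j} → p j ≡ true → ∃[ k ] enum p k ≡ j
enum-surjective {ℕ.suc n} p pj with p zero in eq
enum-surjective {ℕ.suc n} p {zero}  pj | true  = zero , refl
enum-surjective {ℕ.suc n} p {zero}  pj | false with () ← trans (sym eq) pj
enum-surjective {ℕ.suc n} p {suc j} pj | b with enum-surjective (p ∘ suc) pj
enum-surjective {ℕ.suc n} p {suc j} pj | true  | k , e = suc k , cong suc e
enum-surjective {ℕ.suc n} p {suc j} pj | false | k , e = k , cong suc e

count-cong : ∀ {n} {p q : Fin n → Bool} → p ≗ q → count p ≡ count q
count-cong {ℕ.zero}  p≗q = refl
count-cong {ℕ.suc n} {p} {q} p≗q rewrite p≗q zero | count-cong (p≗q ∘ suc) = refl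

count-drop : ∀ {n} {p q : Fin n → Bool} t → p t ≡ true → q t ≡ false →
             (∀ j → j ≢ t → q j ≡ p j) → ℕ.suc (count q) ≡ count p
count-drop {ℕ.suc n} {p} {q} zero pt qt q≡p
  rewrite pt | qt = cong ℕ.suc (count-cong (λ j → q≡p (suc j) λ ()))
count-drop {ℕ.suc n} {p} {q} (suc t) pt qt q≡p
  with count-drop t pt qt (λ j j≢t → q≡p (suc j) (j≢t ∘ suc-injective))
... | ih rewrite q≡p zero (λ ()) with p zero
... | true  = cong ℕ.suc ih
... | false = ih

-- Strings

nonzero : ∀ {m} → Fin (ℕ.suc m) → Bool
nonzero zero    = false
nonzero (suc _) = true

≢zero⇒nonzero : ∀ {m} {x : Fin (ℕ.suc m)} → x ≢ zero → nonzero x ≡ true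
≢zero⇒nonzero {x = zero}  x≢0 = ⊥-elim (x≢0 refl)
≢zero⇒nonzero {x = suc _} _   = refl

support : ∀ {n} → Str n → Fin n → Bool
support X j = nonzero (X j)

#nonzero : ∀ {n} → Str n → ℕ
#nonzero X = count (support X)

column : ∀ {n} (X : Str n) → Fin (#nonzero X) → Fin n
column X = enum (support X)

-- The label suc i selects row i; the value at zero is junk.
labelRow : Fin 4 → Fin 3
labelRow zero    = zero
labelRow (suc i) = i

slotRow : ∀ {n} (X : Str n) → Fin (#nonzero X) → Fin 3
slotRow X k = labelRow (X (column X k))

column-label : ∀ {n} (X : Str n) k → X (column X k) ≡ suc (slotRow X k)
column-label X k = nonzero⇒suc (enum-true (support X) k)
  where
  nonzero⇒suc : ∀ {x : Fin 4} → nonzero x ≡ true → x ≡ suc (labelRow x)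
  nonzero⇒suc {suc _} _ = refl

≡zero⇒≢suc : ∀ {m} {x : Fin (ℕ.suc m)} {i} → x ≡ zero → x ≢ suc i
≡zero⇒≢suc refl ()

column-nonzero : ∀ {n} (X : Str n) k → X (column X k) ≢ zero
column-nonzero X k Xk≡0 = ≡zero⇒≢suc Xk≡0 (column-label X k)

slot-of : ∀ {n} (X : Str n) {i j} → X j ≡ suc i → ∃[ k ] (slotRow X k ≡ i × column X k ≡ j)
slot-of X Xj≡i with enum-surjective (support X) (cong nonzero Xj≡i)
... | k , refl = k , cong labelRow Xj≡i , refl

_≼_ : ∀ {n} → Str n → Str n → Set
Z ≼ X = ∀ j → Z j ≡ X j ⊎ Z j ≡ zero

≼-refl : ∀ {n} {X : Str n} → X ≼ X
≼-refl j = inj₁ refl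

≼-label : ∀ {n} {Z X : Str n} → Z ≼ X → ∀ {i j} → Z j ≡ suc i → X j ≡ suc i
≼-label Z≼X {j = j} Zj≡i with Z≼X j
... | inj₁ Zj≡Xj = trans (sym Zj≡Xj) Zj≡i
... | inj₂ Zj≡0  = ⊥-elim (≡zero⇒≢suc Zj≡0 Zj≡i)

≼-trans : ∀ {n} {Z Y X : Str n} → Z ≼ Y → Y ≼ X → Z ≼ X
≼-trans Z≼Y Y≼X j with Z≼Y j | Y≼X j
... | inj₁ Zj≡Yj | inj₁ Yj≡Xj = inj₁ (trans Zj≡Yj Yj≡Xj)
... | inj₁ Zj≡Yj | inj₂ Yj≡0  = inj₂ (trans Zj≡Yj Yj≡0)
... | inj₂ Zj≡0  | _          = inj₂ Zj≡0

meet-≼ˡ : ∀ {n} (X Y : Str n) → meet X Y ≼ X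
meet-≼ˡ X Y j with X j ≟ Y j
... | yes _ = inj₁ refl
... | no  _ = inj₂ refl

meet-≼ʳ : ∀ {n} (X Y : Str n) → meet X Y ≼ Y
meet-≼ʳ X Y j with X j ≟ Y j
... | yes Xj≡Yj = inj₁ Xj≡Yj
... | no  _     = inj₂ refl

zeroAt-≼ : ∀ {n} (X : Str n) j → zeroAt X j ≼ X
zeroAt-≼ X j k with k ≟ j
... | yes _ = inj₂ refl
... | no  _ = inj₁ refl

zeroAt-self : ∀ {n} (X : Str n) j → zeroAt X j j ≡ zero
zeroAt-self X j with j ≟ j
... | yes _   = refl
... | no  j≢j = ⊥-elim (j≢j refl)

zeroAt-other : ∀ {n} (X : Str n) {j k} → k ≢ j → zeroAt X j k ≡ X k
zeroAt-other X {j} {k} k≢j with k ≟ j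
... | yes k≡j = ⊥-elim (k≢j k≡j)
... | no  _   = refl

zeroAt-≡zero : ∀ {n} (X : Str n) {j k} → zeroAt X j k ≡ zero → k ≡ j ⊎ X k ≡ zero
zeroAt-≡zero X {j} {k} Zk≡0 with k ≟ j
... | yes k≡j = inj₁ k≡j
... | no  _   = inj₂ Zk≡0

#nonzero-zeroAt : ∀ {n} (X : Str n) j → X j ≢ zero → ℕ.suc (#nonzero (zeroAt X j)) ≡ #nonzero X
#nonzero-zeroAt X j Xj≢0 = count-drop j (≢zero⇒nonzero Xj≢0) (cong nonzero (zeroAt-self X j))
  (λ k k≢j → cong nonzero (zeroAt-other X k≢j))

¬¬-∀-Fin : ∀ {m} {P : Fin m → Set} → (∀ k → ¬ ¬ P k) → ¬ ¬ (∀ k → P k)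
¬¬-∀-Fin {ℕ.zero}  _   ¬∀ = ¬∀ λ ()
¬¬-∀-Fin {ℕ.suc m} ¬¬P ¬∀ = ¬¬P zero λ P0 → ¬¬-∀-Fin (¬¬P ∘ suc) λ P+ →
  ¬∀ λ { zero → P0 ; (suc k) → P+ k }

-- Complete ordered fields

module _ (K : CompleteOrderedField) where
  open CompleteOrderedField K renaming (_≤_ to _⊑_)
  open IsTotalOrder isTotalOrder
    using (antisym; total) renaming (refl to ⊑-refl; trans to ⊑-trans; reflexive to ⊑-reflexive)

  totalOrder : TotalOrder 0ℓ 0ℓ 0ℓ
  totalOrder = record { isTotalOrder = isTotalOrder }

  open import Data.List.Extrema totalOrder using (argmax; f[xs]≤f[argmax])

  ring : CommutativeRing 0ℓ 0ℓ
  ring = record { isCommutativeRing = isCommutativeRing }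

  open CommutativeRing ring using
    ( +-comm; +-identityˡ; +-identityʳ; -‿inverseʳ
    ; *-assoc; *-comm; *-identityˡ; *-identityʳ; zeroˡ; zeroʳ; distribˡ; semiring)
  open import Algebra.Properties.Ring (CommutativeRing.ring ring)
    using (-1*x≈-x; -‿involutive; -‿distribˡ-*; //-rightDividesˡ; xyx⁻¹≈y)
  open import Algebra.Properties.Semiring.Sum semiring
    using (sum; sum-cong-≗; sum-remove; sum-replicate; sum-replicate-zero; ∑-distrib-+; *-distribʳ-sum)
  open import Algebra.Properties.Monoid.Mult (CommutativeRing.+-monoid ring)
    renaming (_×_ to _×ₙ_) using ()
  open ≡-Reasoning

  +-nonneg : ∀ {x y} → 0# ⊑ x → 0# ⊑ y → 0# ⊑ x + y
  +-nonneg {x} {y} 0⊑x 0⊑y =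
    ⊑-trans (subst (0# ⊑_) (sym (+-identityˡ y)) 0⊑y) (+-mono-≤ y 0⊑x)

  x⊑x+y : ∀ x {y} → 0# ⊑ y → x ⊑ x + y
  x⊑x+y x {y} 0⊑y = subst₂ _⊑_ (+-identityˡ x) (+-comm y x) (+-mono-≤ x 0⊑y)

  +-nonneg-≡0 : ∀ {x y} → 0# ⊑ x → 0# ⊑ y → x + y ≡ 0# → x ≡ 0# × y ≡ 0#
  +-nonneg-≡0 {x} {y} 0⊑x 0⊑y x+y≡0 =
    antisym (subst (x ⊑_) x+y≡0 (x⊑x+y x 0⊑y)) 0⊑x ,
    antisym (subst (y ⊑_) (trans (+-comm y x) x+y≡0) (x⊑x+y y 0⊑x)) 0⊑y

  0⊑1 : 0# ⊑ 1#
  0⊑1 with total 0# 1#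
  ... | inj₁ 0⊑1 = 0⊑1
  ... | inj₂ 1⊑0 = subst (0# ⊑_) square (*-nonneg 0⊑-1 0⊑-1)
    where
    0⊑-1 : 0# ⊑ - 1#
    0⊑-1 = subst₂ _⊑_ (-‿inverseʳ 1#) (+-identityˡ (- 1#)) (+-mono-≤ (- 1#) 1⊑0)
    square : - 1# * - 1# ≡ 1#
    square = trans (-1*x≈-x (- 1#)) (-‿involutive 1#)

  1⋢0 : ¬ (1# ⊑ 0#)
  1⋢0 1⊑0 = 0≢1 (antisym 0⊑1 1⊑0)

  x≢0⇒x*y≡0⇒y≡0 : ∀ {x y} → x ≢ 0# → x * y ≡ 0# → y ≡ 0#
  x≢0⇒x*y≡0⇒y≡0 {x} {y} x≢0 xy≡0 with inverse x x≢0
  ... | x⁻¹ , xx⁻¹≡1 = begin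
    y              ≡⟨ sym (*-identityˡ y) ⟩
    1# * y         ≡⟨ cong (_* y) (trans (sym xx⁻¹≡1) (*-comm x x⁻¹)) ⟩
    x⁻¹ * x * y    ≡⟨ *-assoc x⁻¹ x y ⟩
    x⁻¹ * (x * y)  ≡⟨ cong (x⁻¹ *_) xy≡0 ⟩
    x⁻¹ * 0#       ≡⟨ zeroʳ x⁻¹ ⟩
    0#             ∎

  -- The supremum u of the multiples of x satisfies u ⊑ u - x.
  archimedean : ∀ {x b} → (∀ k → k ×ₙ x ⊑ b) → x ⊑ 0#
  archimedean {x} {b} bounded
    with complete (λ y → ∃[ k ] y ≡ k ×ₙ x) (0# , 0 , refl) (b , λ { _ (k , refl) → bounded k })
  ... | u , u-upper , u-least =
    subst₂ _⊑_ (xyx⁻¹≈y u x) (-‿inverseʳ u) (+-mono-≤ (- u) u+x⊑u)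
    where
    u⊑u-x : u ⊑ u + - x
    u⊑u-x = u-least (u + - x) λ { _ (k , refl) →
      subst (_⊑ u + - x) (xyx⁻¹≈y x (k ×ₙ x)) (+-mono-≤ (- x) (u-upper _ (ℕ.suc k , refl))) }
    u+x⊑u : u + x ⊑ u
    u+x⊑u = subst (u + x ⊑_) (//-rightDividesˡ x u) (+-mono-≤ x u⊑u-x)

  nonneg-¬¬-stable : ∀ {x} → 0# ⊑ x → ¬ ¬ (x ≡ 0#) → x ≡ 0#
  nonneg-¬¬-stable {x} 0⊑x ¬¬x≡0 = antisym (archimedean multiple⊑1) 0⊑x
    where
    multiple⊑1 : ∀ k → k ×ₙ x ⊑ 1#
    multiple⊑1 k with total (k ×ₙ x) 1#
    ... | inj₁ kx⊑1 = kx⊑1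
    ... | inj₂ 1⊑kx = ⊥-elim (¬¬x≡0 λ { refl →
      1⋢0 (subst (1# ⊑_) (trans (sym (sum-replicate k)) (sum-replicate-zero k)) 1⊑kx) })

  sum-nonneg : ∀ {d} {f : Fin d → Carrier} → (∀ k → 0# ⊑ f k) → 0# ⊑ sum f
  sum-nonneg {ℕ.zero}  _   = ⊑-refl
  sum-nonneg {ℕ.suc d} f≥0 = +-nonneg (f≥0 zero) (sum-nonneg (f≥0 ∘ suc))

  sum-nonneg-≡0 : ∀ {d} {f : Fin d → Carrier} → (∀ k → 0# ⊑ f k) → sum f ≡ 0# → ∀ k → f k ≡ 0#
  sum-nonneg-≡0 {ℕ.suc d} f≥0 Σf≡0 k
    with +-nonneg-≡0 (f≥0 zero) (sum-nonneg (f≥0 ∘ suc)) Σf≡0 | k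
  ... | f0≡0 , _    | zero  = f0≡0
  ... | _    , Σ≡0 | suc k = sum-nonneg-≡0 (f≥0 ∘ suc) Σ≡0 k

  sum-≡0 : ∀ {d} {f : Fin d → Carrier} → (∀ k → f k ≡ 0#) → sum f ≡ 0#
  sum-≡0 {d} f≡0 = trans (sum-cong-≗ f≡0) (sum-replicate-zero d)

  sum-single : ∀ {d} {f : Fin d → Carrier} k₀ → (∀ k → k ≢ k₀ → f k ≡ 0#) → sum f ≡ f k₀
  sum-single {ℕ.suc d} {f} k₀ f≡0 = begin
    sum f                                   ≡⟨ sum-remove {i = k₀} f ⟩
    f k₀ + sum (λ k → f (punchIn k₀ k))     ≡⟨ cong (f k₀ +_) (sum-≡0 λ k → f≡0 _ (punchInᵢ≢i k₀ k)) ⟩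
    f k₀ + 0#                               ≡⟨ +-identityʳ (f k₀) ⟩
    f k₀                                    ∎

  sum-shear : ∀ {m} (a y s : Fin m → Carrier) z →
    sum (λ k → a k * (y k + s k * z)) ≡ sum (λ k → a k * y k) + sum (λ k → a k * s k) * z
  sum-shear a y s z = begin
    sum (λ k → a k * (y k + s k * z))               ≡⟨ sum-cong-≗ expand ⟩
    sum (λ k → a k * y k + a k * s k * z)           ≡⟨ ∑-distrib-+ (λ k → a k * y k) (λ k → a k * s k * z) ⟩
    sum (λ k → a k * y k) + sum (λ k → a k * s k * z)
      ≡⟨ cong (sum (λ k → a k * y k) +_) (sym (*-distribʳ-sum z (λ k → a k * s k))) ⟩
    sum (λ k → a k * y k) + sum (λ k → a k * s k) * z  ∎
    where
    expand : ∀ k → a k * (y k + s k * z) ≡ a k * y k + a k * s k * z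
    expand k = trans (distribˡ (a k) _ _) (cong (a k * y k +_) (sym (*-assoc (a k) (s k) z)))

  -- Linear independence of coordinate vectors

  combination : ∀ {m d} → (Fin m → Carrier) → (Fin m → Fin d → Carrier) → Fin d → Carrier
  combination a v c = sum λ k → a k * v k c

  Independent : ∀ {m d} → (Fin m → Fin d → Carrier) → Set
  Independent v = ∀ a → (∀ c → combination a v c ≡ 0#) → ∀ k → a k ≡ 0#

  Independent-shear : ∀ {m d} {v : Fin (ℕ.suc m) → Fin d → Carrier} r (s : Fin m → Carrier) →
    Independent v → Independent (λ k c → v (punchIn r k) c + s k * v r c)
  Independent-shear {v = v} r s v-indep a Σ≡0 k = begin
    a k                           ≡⟨ sym (insertAt-punchIn a r t k) ⟩
    insertAt a r t (punchIn r k)  ≡⟨ v-indep (insertAt a r t) extended≡0 (punchIn r k) ⟩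
    0#                            ∎
    where
    t : Carrier
    t = sum λ k → a k * s k
    extended≡0 : ∀ c → combination (insertAt a r t) v c ≡ 0#
    extended≡0 c = begin
      combination (insertAt a r t) v c
        ≡⟨ sum-remove {i = r} (λ k → insertAt a r t k * v k c) ⟩
      insertAt a r t r * v r c + sum (λ k → insertAt a r t (punchIn r k) * v (punchIn r k) c)
        ≡⟨ cong₂ _+_ (cong (_* v r c) (insertAt-lookup a r t))
                     (sum-cong-≗ λ k → cong (_* v (punchIn r k) c) (insertAt-punchIn a r t k)) ⟩
      t * v r c + sum (λ k → a k * v (punchIn r k) c)
        ≡⟨ +-comm _ _ ⟩
      sum (λ k → a k * v (punchIn r k) c) + t * v r c
        ≡⟨ sym (sum-shear a (λ k → v (punchIn r k) c) s (v r c)) ⟩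
      sum (λ k → a k * (v (punchIn r k) c + s k * v r c))
        ≡⟨ Σ≡0 c ⟩
      0#  ∎

  Independent-tail : ∀ {m d} {v : Fin m → Fin (ℕ.suc d) → Carrier} → (∀ k → v k zero ≡ 0#) →
    Independent v → Independent (λ k c → v k (suc c))
  Independent-tail v0≡0 v-indep a Σ≡0 = v-indep a λ
    { zero    → sum-≡0 λ k → trans (cong (a k *_) (v0≡0 k)) (zeroʳ (a k))
    ; (suc c) → Σ≡0 c }

  pivot-cancels : ∀ x y → x ≢ 0# → Σ Carrier λ s → y + s * x ≡ 0#
  pivot-cancels x y x≢0 with inverse x x≢0
  ... | x⁻¹ , xx⁻¹≡1 = - (y * x⁻¹) , (begin
    y + - (y * x⁻¹) * x    ≡⟨ cong (y +_) (sym (-‿distribˡ-* (y * x⁻¹) x)) ⟩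
    y + - (y * x⁻¹ * x)    ≡⟨ cong (λ z → y + - z) (*-assoc y x⁻¹ x) ⟩
    y + - (y * (x⁻¹ * x))  ≡⟨ cong (λ z → y + - (y * z)) (trans (*-comm x⁻¹ x) xx⁻¹≡1) ⟩
    y + - (y * 1#)         ≡⟨ cong (λ z → y + - z) (*-identityʳ y) ⟩
    y + - y                ≡⟨ -‿inverseʳ y ⟩
    0#                     ∎)

  -- Gaussian elimination on the first coordinate.  Since equality in K is undecidable,
  -- the split into "some vector has a nonzero first coordinate" or not is done under ¬¬,
  -- which is harmless because m ≤ d is decidable.
  Independent⇒≤ : ∀ {m d} (v : Fin m → Fin d → Carrier) → Independent v → m ℕ.≤ d
  Independent⇒≤ {ℕ.zero}            v v-indep = ℕ.z≤n
  Independent⇒≤ {ℕ.suc m} {ℕ.zero}  v v-indep = ⊥-elim (0≢1 (sym (v-indep (λ _ → 1#) (λ ()) zero)))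
  Independent⇒≤ {ℕ.suc m} {ℕ.suc d} v v-indep =
    decidable-stable (ℕ.suc m ℕ.≤? ℕ.suc d) λ m≰d → ¬¬-excluded-middle λ pivot? → bound pivot? m≰d
    where
    bound : Dec (∃[ r ] v r zero ≢ 0#) → ¬ ¬ (ℕ.suc m ℕ.≤ ℕ.suc d)
    bound (yes (r , vr≢0)) m≰d = m≰d (ℕ.s≤s (Independent⇒≤ (λ k c → sheared k (suc c))
      (Independent-tail {v = sheared} (λ k → proj₂ (cancel k)) (Independent-shear {v = v} r s v-indep))))
      where
      cancel : ∀ k → Σ Carrier λ s → v (punchIn r k) zero + s * v r zero ≡ 0#
      cancel k = pivot-cancels (v r zero) (v (punchIn r k) zero) vr≢0
      s : Fin m → Carrier
      s k = proj₁ (cancel k)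
      sheared : Fin m → Fin (ℕ.suc d) → Carrier
      sheared k c = v (punchIn r k) c + s k * v r c
    bound (no ∄r) = ¬¬-map
      (λ v0≡0 → m≤n⇒m≤1+n (Independent⇒≤ (λ k c → v k (suc c)) (Independent-tail {v = v} v0≡0 v-indep)))
      (¬¬-∀-Fin λ r vr≢0 → ∄r (r , vr≢0))

  -- The cones Δ X

  open Cones K

  𝟙 : ∀ {A : Set} → Dec A → Carrier
  𝟙 (yes _) = 1#
  𝟙 (no  _) = 0#

  𝟙-yes : ∀ {A : Set} (a? : Dec A) → A → 𝟙 a? ≡ 1#
  𝟙-yes (yes _) _ = refl
  𝟙-yes (no ¬a) a = ⊥-elim (¬a a)

  𝟙-no : ∀ {A : Set} (a? : Dec A) → ¬ A → 𝟙 a? ≡ 0#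
  𝟙-no (yes a) ¬a = ⊥-elim (¬a a)
  𝟙-no (no  _) _  = refl

  𝟙-nonneg : ∀ {A : Set} (a? : Dec A) → 0# ⊑ 𝟙 a?
  𝟙-nonneg (yes _) = 0⊑1
  𝟙-nonneg (no  _) = ⊑-refl

  E : ∀ {n} → Fin 3 → Fin n → Mat n
  E i₀ j₀ i j = 𝟙 ((i ≟ i₀) ×-dec (j ≟ j₀))

  E-diag : ∀ {n} i (j : Fin n) → E i j i j ≡ 1#
  E-diag i j = 𝟙-yes ((i ≟ i) ×-dec (j ≟ j)) (refl , refl)

  E-off : ∀ {n} {i₀ i} {j₀ j : Fin n} → ¬ (i ≡ i₀ × j ≡ j₀) → E i₀ j₀ i j ≡ 0#
  E-off {i₀ = i₀} {i} {j₀} {j} = 𝟙-no ((i ≟ i₀) ×-dec (j ≟ j₀))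

  sumFin≡sum : ∀ {d} (f : Fin d → Carrier) → sumFin f ≡ sum f
  sumFin≡sum {ℕ.zero}  f = refl
  sumFin≡sum {ℕ.suc d} f = cong (f zero +_) (sumFin≡sum (f ∘ suc))

  pair≡∑∑ : ∀ {n} (W M : Mat n) → pair W M ≡ sum (λ i → sum (λ j → W i j * M i j))
  pair≡∑∑ W M = trans (sumFin≡sum (λ i → sumFin (λ j → W i j * M i j)))
                     (sum-cong-≗ λ i → sumFin≡sum (λ j → W i j * M i j))

  pair-nonneg : ∀ {n} (W M : Mat n) → (∀ i j → 0# ⊑ W i j * M i j) → 0# ⊑ pair W M
  pair-nonneg W M terms≥0 =
    subst (0# ⊑_) (sym (pair≡∑∑ W M)) (sum-nonneg λ i → sum-nonneg (terms≥0 i))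

  pair-≡0 : ∀ {n} (W M : Mat n) → (∀ i j → W i j * M i j ≡ 0#) → pair W M ≡ 0#
  pair-≡0 W M terms≡0 = trans (pair≡∑∑ W M) (sum-≡0 λ i → sum-≡0 (terms≡0 i))

  pair-≡0⇒terms≡0 : ∀ {n} (W M : Mat n) → (∀ i j → 0# ⊑ W i j * M i j) → pair W M ≡ 0# →
                    ∀ i j → W i j * M i j ≡ 0#
  pair-≡0⇒terms≡0 W M terms≥0 pair≡0 i =
    sum-nonneg-≡0 (terms≥0 i)
      (sum-nonneg-≡0 (λ i → sum-nonneg (terms≥0 i)) (trans (sym (pair≡∑∑ W M)) pair≡0) i)

  pair-E : ∀ {n} (W : Mat n) i₀ j₀ → pair W (E i₀ j₀) ≡ W i₀ j₀
  pair-E W i₀ j₀ = begin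
    pair W (E i₀ j₀)                              ≡⟨ pair≡∑∑ W (E i₀ j₀) ⟩
    sum (λ i → sum (λ j → W i j * E i₀ j₀ i j))   ≡⟨ sum-single i₀ (λ i i≢i₀ → sum-≡0 λ j → off {i} {j} (i≢i₀ ∘ proj₁)) ⟩
    sum (λ j → W i₀ j * E i₀ j₀ i₀ j)             ≡⟨ sum-single j₀ (λ j j≢j₀ → off {i₀} {j} (j≢j₀ ∘ proj₂)) ⟩
    W i₀ j₀ * E i₀ j₀ i₀ j₀                       ≡⟨ cong (W i₀ j₀ *_) (E-diag i₀ j₀) ⟩
    W i₀ j₀ * 1#                                  ≡⟨ *-identityʳ (W i₀ j₀) ⟩
    W i₀ j₀                                       ∎
    where
    off : ∀ {i j} → ¬ (i ≡ i₀ × j ≡ j₀) → W i j * E i₀ j₀ i j ≡ 0#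
    off {i} {j} ¬diag = trans (cong (W i j *_) (E-off ¬diag)) (zeroʳ (W i j))

  Δ-intro : ∀ {n} {X : Str n} {M} → (∀ i j → 0# ⊑ M i j) → (∀ i j → X j ≢ suc i → M i j ≡ 0#) → Δ X M
  Δ-intro M≥0 M≡0 i j = (λ _ → M≥0 i j) , M≡0 i j

  Δ-nonneg : ∀ {n} {X : Str n} {M} → Δ X M → ∀ i j → 0# ⊑ M i j
  Δ-nonneg {X = X} ΔM i j with X j ≟ suc i
  ... | yes Xj≡i = proj₁ (ΔM i j) Xj≡i
  ... | no  Xj≢i = ⊑-reflexive (sym (proj₂ (ΔM i j) Xj≢i))

  Δ-resp : ∀ {n} {X : Str n} {M N} → (∀ i j → M i j ≡ N i j) → Δ X N → Δ X M
  Δ-resp M≡N ΔN = Δ-intro (λ i j → subst (0# ⊑_) (sym (M≡N i j)) (Δ-nonneg ΔN i j))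
                          (λ i j Xj≢i → trans (M≡N i j) (proj₂ (ΔN i j) Xj≢i))

  Δ-E : ∀ {n} {X : Str n} {i j} → X j ≡ suc i → Δ X (E i j)
  Δ-E {i = i₀} {j₀} Xj₀≡i₀ = Δ-intro (λ i j → 𝟙-nonneg ((i ≟ i₀) ×-dec (j ≟ j₀)))
    λ i j Xj≢i → E-off {i₀ = i₀} {i} {j₀} {j} λ { (refl , refl) → Xj≢i Xj₀≡i₀ }

  Δ-mono : ∀ {n} {Z X : Str n} → Z ≼ X → ∀ {M} → Δ Z M → Δ X M
  Δ-mono Z≼X ΔZ = Δ-intro (Δ-nonneg ΔZ) λ i j Xj≢i → proj₂ (ΔZ i j) (Xj≢i ∘ ≼-label Z≼X)

  Δ-restrict : ∀ {n} {Z X : Str n} → Z ≼ X → ∀ {M} → Δ X M →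
               (∀ i j → X j ≡ suc i → Z j ≡ zero → M i j ≡ 0#) → Δ Z M
  Δ-restrict {Z = Z} {X} Z≼X {M} ΔX dropped≡0 = Δ-intro (Δ-nonneg ΔX) vanish
    where
    vanish : ∀ i j → Z j ≢ suc i → M i j ≡ 0#
    vanish i j Zj≢i with Z≼X j | X j ≟ suc i
    ... | inj₁ Zj≡Xj | _        = proj₂ (ΔX i j) (Zj≢i ∘ trans Zj≡Xj)
    ... | inj₂ Zj≡0  | yes Xj≡i = dropped≡0 i j Xj≡i Zj≡0
    ... | inj₂ _     | no  Xj≢i = proj₂ (ΔX i j) Xj≢i

  lincomb≡sum : ∀ {n d} (c : Fin d → Carrier) (g : Fin d → Mat n) i j →
                lincomb c g i j ≡ sum (λ k → c k * g k i j)
  lincomb≡sum c g i j = sumFin≡sum (λ k → c k * g k i j)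

  generator : ∀ {n} (X : Str n) → Fin (#nonzero X) → Mat n
  generator X k = E (slotRow X k) (column X k)

  coordinate : ∀ {n} (X : Str n) → Mat n → Fin (#nonzero X) → Carrier
  coordinate X M k = M (slotRow X k) (column X k)

  Δ-generator : ∀ {n} (X : Str n) k → Δ X (generator X k)
  Δ-generator X k = Δ-E (column-label X k)

  lincomb-off : ∀ {n d} {X : Str n} (c : Fin d → Carrier) {g : Fin d → Mat n} →
                (∀ k → Δ X (g k)) → ∀ {i j} → X j ≢ suc i → lincomb c g i j ≡ 0#
  lincomb-off c {g} g∈Δ {i} {j} Xj≢i = trans (lincomb≡sum c g i j) (sum-≡0 λ k →
    trans (cong (c k *_) (proj₂ (g∈Δ k i j) Xj≢i)) (zeroʳ (c k)))

  Δ-lincomb : ∀ {n d} {X : Str n} {c : Fin d → Carrier} {g : Fin d → Mat n} →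
              (∀ k → 0# ⊑ c k) → (∀ k → Δ X (g k)) → Δ X (lincomb c g)
  Δ-lincomb {c = c} {g} c≥0 g∈Δ = Δ-intro
    (λ i j → subst (0# ⊑_) (sym (lincomb≡sum c g i j)) (sum-nonneg λ k → *-nonneg (c≥0 k) (Δ-nonneg (g∈Δ k) i j)))
    (λ i j → lincomb-off c g∈Δ)

  lincomb-generator : ∀ {n} (X : Str n) c k → lincomb c (generator X) (slotRow X k) (column X k) ≡ c k
  lincomb-generator X c k = begin
    lincomb c (generator X) (slotRow X k) (column X k)
      ≡⟨ lincomb≡sum c (generator X) (slotRow X k) (column X k) ⟩
    sum (λ l → c l * generator X l (slotRow X k) (column X k))
      ≡⟨ sum-single k (λ l l≢k → trans (cong (c l *_) (E-off {i₀ = slotRow X l} {slotRow X k} {column X l}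
                                         (l≢k ∘ sym ∘ enum-injective (support X) ∘ proj₂)))
                                       (zeroʳ (c l))) ⟩
    c k * generator X k (slotRow X k) (column X k)
      ≡⟨ cong (c k *_) (E-diag (slotRow X k) (column X k)) ⟩
    c k * 1#
      ≡⟨ *-identityʳ (c k) ⟩
    c k  ∎

  generator-independent : ∀ {n} (X : Str n) → LinIndep (generator X)
  generator-independent X c lincomb≡0 k = trans (sym (lincomb-generator X c k)) (lincomb≡0 (slotRow X k) (column X k))

  Δ-decompose : ∀ {n} (X : Str n) {M} → Δ X M → ∀ i j → M i j ≡ lincomb (coordinate X M) (generator X) i j
  Δ-decompose X {M} ΔM i j with X j ≟ suc i
  ... | no Xj≢i = trans (proj₂ (ΔM i j) Xj≢i) (sym (lincomb-off _ (Δ-generator X) Xj≢i))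
  ... | yes Xj≡i with slot-of X Xj≡i
  ...   | k , refl , refl = sym (lincomb-generator X (coordinate X M) k)

  Δ-simplicial : ∀ {n} (X : Str n) → SimplicialCone (Δ X)
  Δ-simplicial X = #nonzero X , generator X , generator-independent X , λ M →
    (λ ΔM → coordinate X M , (λ k → Δ-nonneg ΔM _ _) , Δ-decompose X ΔM) ,
    (λ { (c , c≥0 , M≡) → Δ-resp M≡ (Δ-lincomb c≥0 (Δ-generator X)) })

  LinIndep-tail : ∀ {n m} {g : Fin (ℕ.suc m) → Mat n} → LinIndep g → LinIndep (g ∘ suc)
  LinIndep-tail {g = g} g-indep c lincomb≡0 k = g-indep (0# ∷ c)
    (λ i j → trans (cong₂ _+_ (zeroˡ (g zero i j)) (lincomb≡0 i j)) (+-identityˡ 0#)) (suc k)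

  HasDim⇒≤ : ∀ {n d m} {C : Mat n → Set} → HasDim C d →
             (g : Fin m → Mat n) → (∀ k → C (g k)) → LinIndep g → m ℕ.≤ d
  HasDim⇒≤ {m = ℕ.zero}  _ _ _ _ = ℕ.z≤n
  HasDim⇒≤ {m = ℕ.suc m} {C} dimC g g∈C g-indep
    with m≤n⇒m<n∨m≡n (HasDim⇒≤ {C = C} dimC (g ∘ suc) (g∈C ∘ suc) (LinIndep-tail {g = g} g-indep))
  ... | inj₁ m<d  = m<d
  ... | inj₂ refl = ⊥-elim (proj₂ dimC g g∈C g-indep)

  HasDim-unique : ∀ {n a b} {C : Mat n → Set} → HasDim C a → HasDim C b → a ≡ b
  HasDim-unique {C = C} dimA@((gA , gA∈C , gA-indep) , _) dimB@((gB , gB∈C , gB-indep) , _) =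
    ≤-antisym (HasDim⇒≤ {C = C} dimB gA gA∈C gA-indep) (HasDim⇒≤ {C = C} dimA gB gB∈C gB-indep)

  coordinates-independent : ∀ {n m} (X : Str n) {g : Fin m → Mat n} → (∀ k → Δ X (g k)) →
                            LinIndep g → Independent (λ k → coordinate X (g k))
  coordinates-independent X {g} g∈Δ g-indep a Σ≡0 = g-indep a lincomb≡0
    where
    lincomb≡0 : ∀ i j → lincomb a g i j ≡ 0#
    lincomb≡0 i j with X j ≟ suc i
    ... | no Xj≢i = lincomb-off a g∈Δ Xj≢i
    ... | yes Xj≡i with slot-of X Xj≡i
    ...   | k , refl , refl = trans (lincomb≡sum a g _ _) (Σ≡0 k)

  HasDim-Δ : ∀ {n} (X : Str n) → HasDim (Δ X) (#nonzero X)
  HasDim-Δ X = (generator X , Δ-generator X , generator-independent X) , λ g g∈Δ g-indep →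
    n≮n _ (Independent⇒≤ (λ k → coordinate X (g k)) (coordinates-independent X g∈Δ g-indep))

  -- Faces and facets

  Δ-∩ : ∀ {n} (X Y : Str n) → (Δ X ∩ Δ Y) ≐ Δ (meet X Y)
  Δ-∩ X Y M = (λ (ΔX , ΔY) → Δ-restrict (meet-≼ˡ X Y) ΔX (vanish ΔY)) ,
              (λ Δmeet → Δ-mono (meet-≼ˡ X Y) Δmeet , Δ-mono (meet-≼ʳ X Y) Δmeet)
    where
    vanish : Δ Y M → ∀ i j → X j ≡ suc i → meet X Y j ≡ zero → M i j ≡ 0#
    vanish ΔY i j Xj≡i meet≡0 with X j ≟ Y j
    ... | yes _     = ⊥-elim (≡zero⇒≢suc meet≡0 Xj≡i)
    ... | no  Xj≢Yj = proj₂ (ΔY i j) λ Yj≡i → Xj≢Yj (trans Xj≡i (sym Yj≡i))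

  Face-≼ : ∀ {n} {Z X : Str n} → Z ≼ X → Face (Δ Z) (Δ X)
  Face-≼ {n} {Z} {X} Z≼X = W , (λ M ΔX → pair-nonneg W M (terms≥0 ΔX)) , λ M → Δ⇒zero M , zero⇒Δ M
    where
    W : Mat n
    W i j = 𝟙 (Z j ≟ zero)
    terms≥0 : ∀ {M} → Δ X M → ∀ i j → 0# ⊑ W i j * M i j
    terms≥0 ΔX i j = *-nonneg (𝟙-nonneg (Z j ≟ zero)) (Δ-nonneg ΔX i j)
    Δ⇒zero : ∀ M → Δ Z M → Δ X M × pair W M ≡ 0#
    Δ⇒zero M ΔZ = Δ-mono Z≼X ΔZ , pair-≡0 W M term≡0
      where
      term≡0 : ∀ i j → W i j * M i j ≡ 0#
      term≡0 i j with Z j ≟ zero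
      ... | yes Zj≡0 = trans (cong (1# *_) (proj₂ (ΔZ i j) (≡zero⇒≢suc Zj≡0))) (zeroʳ 1#)
      ... | no  _    = zeroˡ (M i j)
    zero⇒Δ : ∀ M → Δ X M × pair W M ≡ 0# → Δ Z M
    zero⇒Δ M (ΔX , pair≡0) = Δ-restrict Z≼X ΔX λ i j _ Zj≡0 → begin
      M i j          ≡⟨ sym (*-identityˡ (M i j)) ⟩
      1# * M i j     ≡⟨ cong (_* M i j) (sym (𝟙-yes (Z j ≟ zero) Zj≡0)) ⟩
      W i j * M i j  ≡⟨ pair-≡0⇒terms≡0 W M (terms≥0 ΔX) pair≡0 i j ⟩
      0#             ∎

  Face-≐ : ∀ {n} {F G C : Mat n → Set} → G ≐ F → Face F C → Face G C
  Face-≐ G≐F (W , W≥0 , F-char) = W , W≥0 , λ M →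
    (proj₁ (F-char M) ∘ proj₁ (G≐F M)) , (proj₂ (G≐F M) ∘ proj₂ (F-char M))

  HasDim-≐ : ∀ {n d} {F G : Mat n → Set} → G ≐ F → HasDim F d → HasDim G d
  HasDim-≐ G≐F ((g , g∈F , g-indep) , bound) =
    (g , (λ k → proj₂ (G≐F _) (g∈F k)) , g-indep) , λ h h∈G → bound h (λ k → proj₁ (G≐F _) (h∈G k))

  Facet-zeroAt : ∀ {n} (X : Str n) j → X j ≢ zero → Facet (Δ (zeroAt X j)) (Δ X)
  Facet-zeroAt X j Xj≢0 = Face-≼ (zeroAt-≼ X j) , #nonzero (zeroAt X j) ,
    subst (HasDim (Δ X)) (sym (#nonzero-zeroAt X j Xj≢0)) (HasDim-Δ X) , HasDim-Δ (zeroAt X j)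

  zeroAt⇒Facet : ∀ {n} {X : Str n} {G} → ∃[ j ] (X j ≢ zero × (G ≐ Δ (zeroAt X j))) → Facet G (Δ X)
  zeroAt⇒Facet {X = X} (j , Xj≢0 , G≐Δ) with Facet-zeroAt X j Xj≢0
  ... | face , d , dimX , dimZ = Face-≐ G≐Δ face , d , dimX , HasDim-≐ G≐Δ dimZ

  module FaceOfΔ {n} {X : Str n} {G : Mat n → Set} (face : Face G (Δ X)) where

    W : Mat n
    W = proj₁ face

    G-char : ∀ M → (G M → Δ X M × pair W M ≡ 0#) × (Δ X M × pair W M ≡ 0# → G M)
    G-char = proj₂ (proj₂ face)

    weight : Fin (#nonzero X) → Carrier
    weight k = W (slotRow X k) (column X k)

    weight-nonneg : ∀ k → 0# ⊑ weight k
    weight-nonneg k = subst (0# ⊑_) (pair-E W _ _) (proj₁ (proj₂ face) _ (Δ-generator X k))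

    terms≥0 : ∀ {M} → Δ X M → ∀ i j → 0# ⊑ W i j * M i j
    terms≥0 {M} ΔM i j with X j ≟ suc i
    ... | no Xj≢i = ⊑-reflexive (sym (trans (cong (W i j *_) (proj₂ (ΔM i j) Xj≢i)) (zeroʳ (W i j))))
    ... | yes Xj≡i with slot-of X Xj≡i
    ...   | k , refl , refl = *-nonneg (weight-nonneg k) (Δ-nonneg ΔM _ _)

    G⊆Δ : ∀ {M} → G M → Δ X M
    G⊆Δ {M} = proj₁ ∘ proj₁ (G-char M)

    G⊆Δ-restrict : ∀ {Z} → Z ≼ X → (∀ k → Z (column X k) ≡ zero → weight k ≢ 0#) →
                   ∀ {M} → G M → Δ Z M
    G⊆Δ-restrict {Z} Z≼X dropped≢0 {M} M∈G = Δ-restrict Z≼X (G⊆Δ M∈G) vanish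
      where
      terms≡0 : ∀ i j → W i j * M i j ≡ 0#
      terms≡0 = pair-≡0⇒terms≡0 W M (terms≥0 (G⊆Δ M∈G)) (proj₂ (proj₁ (G-char M) M∈G))
      vanish : ∀ i j → X j ≡ suc i → Z j ≡ zero → M i j ≡ 0#
      vanish i j Xj≡i Zj≡0 with slot-of X Xj≡i
      ... | k , refl , refl = x≢0⇒x*y≡0⇒y≡0 (dropped≢0 k Zj≡0) (terms≡0 _ _)

    Δ⊆G : ∀ {Z} → Z ≼ X → (∀ k → Z (column X k) ≢ zero → weight k ≡ 0#) → ∀ {M} → Δ Z M → G M
    Δ⊆G {Z} Z≼X kept≡0 {M} ΔZ = proj₂ (G-char M) (Δ-mono Z≼X ΔZ , pair-≡0 W M terms≡0)
      where
      terms≡0 : ∀ i j → W i j * M i j ≡ 0#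
      terms≡0 i j with Z j ≟ suc i
      ... | no Zj≢i = trans (cong (W i j *_) (proj₂ (ΔZ i j) Zj≢i)) (zeroʳ (W i j))
      ... | yes Zj≡i with slot-of X (≼-label Z≼X Zj≡i)
      ...   | k , refl , refl =
        trans (cong (_* M _ _) (kept≡0 k λ Zk≡0 → ≡zero⇒≢suc Zk≡0 Zj≡i)) (zeroˡ (M _ _))

  module FacetOfΔ {n} {X : Str n} {G : Mat n → Set} (facet : Facet G (Δ X)) where
    open FaceOfΔ (proj₁ facet)

    d : ℕ
    d = proj₁ (proj₂ facet)

    dimX : HasDim (Δ X) (ℕ.suc d)
    dimX = proj₁ (proj₂ (proj₂ facet))

    dimG : HasDim G d
    dimG = proj₂ (proj₂ (proj₂ facet))

    #nonzero≡ : #nonzero X ≡ ℕ.suc d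
    #nonzero≡ = HasDim-unique {C = Δ X} (HasDim-Δ X) dimX

    d≤dim-enclosing : ∀ {Z} → (∀ {M} → G M → Δ Z M) → d ℕ.≤ #nonzero Z
    d≤dim-enclosing {Z} G⊆ΔZ with proj₁ dimG
    ... | g , g∈G , g-indep = HasDim⇒≤ {C = Δ Z} (HasDim-Δ Z) g (G⊆ΔZ ∘ g∈G) g-indep

    -- Taking the heaviest column, rather than some column of nonzero weight,
    -- avoids deciding equality with 0.

    heaviest : Fin (#nonzero X)
    heaviest = argmax weight (subst Fin (sym #nonzero≡) zero) (allFin _)

    weight⊑heaviest : ∀ k → weight k ⊑ weight heaviest
    weight⊑heaviest k = All.lookup (f[xs]≤f[argmax] _ (allFin _)) (∈-allFin k)

    same-column : ∀ {k l} → column X l ≡ column X k → weight k ≢ 0# → weight l ≢ 0#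
    same-column col≡ rewrite enum-injective (support X) col≡ = λ wk≢0 → wk≢0

    heaviest≢0 : weight heaviest ≢ 0#
    heaviest≢0 wmax≡0 = n≮n d (subst (ℕ._≤ d) #nonzero≡
      (HasDim⇒≤ {C = G} dimG (generator X)
        (λ k → Δ⊆G ≼-refl (λ l _ → all≡0 l) (Δ-generator X k)) (generator-independent X)))
      where
      all≡0 : ∀ k → weight k ≡ 0#
      all≡0 k = antisym (subst (weight k ⊑_) wmax≡0 (weight⊑heaviest k)) (weight-nonneg k)

    top : Fin n
    top = column X heaviest

    -- A second nonzero weight would confine G to a cone of dimension d - 1.
    lighter≡0 : ∀ k → k ≢ heaviest → weight k ≡ 0#
    lighter≡0 k k≢h = nonneg-¬¬-stable (weight-nonneg k) λ wk≢0 →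
      n≮n _ (subst (ℕ._≤ #nonzero Z) (sym (cong ℕ.pred #nonzero-Z))
                   (d≤dim-enclosing (G⊆Δ-restrict Z≼X (dropped≢0 wk≢0))))
      where
      Y Z : Str n
      Y = zeroAt X top
      Z = zeroAt Y (column X k)
      Z≼X : Z ≼ X
      Z≼X = ≼-trans (zeroAt-≼ Y (column X k)) (zeroAt-≼ X top)
      #nonzero-Z : ℕ.suc (ℕ.suc (#nonzero Z)) ≡ ℕ.suc d
      #nonzero-Z = begin
        ℕ.suc (ℕ.suc (#nonzero Z)) ≡⟨ cong ℕ.suc (#nonzero-zeroAt Y (column X k) Yk≢0) ⟩
        ℕ.suc (#nonzero Y)         ≡⟨ #nonzero-zeroAt X top (column-nonzero X heaviest) ⟩
        #nonzero X                 ≡⟨ #nonzero≡ ⟩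
        ℕ.suc d                    ∎
        where
        Yk≢0 : Y (column X k) ≢ zero
        Yk≢0 = subst (_≢ zero) (sym (zeroAt-other X (k≢h ∘ enum-injective (support X)))) (column-nonzero X k)
      dropped≢0 : weight k ≢ 0# → ∀ l → Z (column X l) ≡ zero → weight l ≢ 0#
      dropped≢0 wk≢0 l Zl≡0 with zeroAt-≡zero Y Zl≡0
      ... | inj₁ col≡k = same-column col≡k wk≢0
      ... | inj₂ Yl≡0 with zeroAt-≡zero X Yl≡0
      ...   | inj₁ col≡top = same-column col≡top heaviest≢0
      ...   | inj₂ Xl≡0    = ⊥-elim (column-nonzero X l Xl≡0)

    G≐Δ : G ≐ Δ (zeroAt X top)
    G≐Δ M = G⊆Δ-restrict (zeroAt-≼ X top) dropped≢0 , Δ⊆G (zeroAt-≼ X top) kept≡0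
      where
      dropped≢0 : ∀ l → zeroAt X top (column X l) ≡ zero → weight l ≢ 0#
      dropped≢0 l Yl≡0 with zeroAt-≡zero X Yl≡0
      ... | inj₁ col≡top = same-column col≡top heaviest≢0
      ... | inj₂ Xl≡0    = ⊥-elim (column-nonzero X l Xl≡0)
      kept≡0 : ∀ l → zeroAt X top (column X l) ≢ zero → weight l ≡ 0#
      kept≡0 l Yl≢0 with l ≟ heaviest
      ... | yes refl = ⊥-elim (Yl≢0 (zeroAt-self X top))
      ... | no  l≢h  = lighter≡0 l l≢h

  Facet⇒zeroAt : ∀ {n} {X : Str n} {G} → Facet G (Δ X) → ∃[ j ] (X j ≢ zero × (G ≐ Δ (zeroAt X j)))
  Facet⇒zeroAt {X = X} facet = top , column-nonzero X heaviest , G≐Δ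
    where open FacetOfΔ facet

mainTheorem1 : (K : CompleteOrderedField) (n : ℕ) → 1 ≤ n →
    let open Cones K in
      ((X : Str n) → NonConstant X → SimplicialCone (Δ X))
      × ((X Y : Str n) → NonConstant X → NonConstant Y →
           ((Δ X ∩ Δ Y) ≐ Δ (meet X Y))
           × Face (Δ (meet X Y)) (Δ X) × Face (Δ (meet X Y)) (Δ Y))
      × ((X : Str n) → NonConstant X → (G : Mat n → Set) →
           (Facet G (Δ X) → ∃[ j ] (X j ≢ zero × (G ≐ Δ (zeroAt X j))))
           × (∃[ j ] (X j ≢ zero × (G ≐ Δ (zeroAt X j))) → Facet G (Δ X)))
mainTheorem1 K n _ =
  (λ X _ → Δ-simplicial K X) ,
  (λ X Y _ _ → Δ-∩ K X Y , Face-≼ K (meet-≼ˡ X Y) , Face-≼ K (meet-≼ʳ X Y)) ,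
  (λ X _ G → Facet⇒zeroAt K , zeroAt⇒Facet K)
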